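{- Let $A$ be the adjacency matrix of a doubly regular tournament on $n$ vertices, and let $A'=J-I-A$. Then the incidence structure $(\mathcal{V}_A,\mathcal{B}_{A+I}\cup\mathcal{B}_{A'+I})$ is a $2$-$(n,\frac{n+1}{2},\frac{n+1}{2})$ design and a $3$-$(n,\frac{n+1}{2},\frac{n-3}{4})$ adesign.
   Context: $J$ denotes the all-one matrix and $I$ the identity matrix. A tournament on $n$ vertices is a directed graph in which every pair of distinct vertices is joined by exactly one arc; its adjacency matrix $A$ has $(A)_{xy}=1$ iff there is an arc $xy$. It is doubly regular if every vertex has in-degree and out-degree $\frac{n-1}{2}$, and every pair of distinct vertices has exactly $\frac{n-3}{4}$ common out-neighbours and the same number of common in-neighbours. For a $0$-$1$ matrix $M$ with rows and columns indexed by the vertex set, $\mathcal{V}_M$ denotes the set indexing the columns and $\mathcal{B}_M$ the collection of supports of the rows of $M$ (one block per row); the union is the collection of all these $2n$ blocks. A $t$-$(v,k,\lambda)$ design has $v$ points, all blocks of size $k$, and every $t$-subset of points in exactly $\lambda$ blocks. A $t$-$(v,k,\lambda)$ adesign has $v$ points, all blocks of size $k$, every $t$-subset in either $\lambda$ or $\lambda+1$ blocks for a positive integer $\lambda$, and is not a $t$-design. -}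

module Defs where

open import Data.Nat using (ℕ; zero; suc; _+_; _*_; _∸_; _≡ᵇ_; _<_)
open import Data.Bool using (Bool; true; false; not; if_then_else_)
open import Data.Fin using (Fin; _≟_)
open import Data.Fin.Subset using (Subset; ∣_∣; _⊆_)
open import Data.Fin.Subset.Properties using (_⊆?_)
open import Data.Nat.ListAction using (sum)
open import Data.List using (List; map; allFin; _++_; length; filter)
open import Data.List.Relation.Unary.All using (All)
open import Data.Vec using (tabulate)
open import Data.Product using (_×_; ∃)
open import Data.Sum using (_⊎_)
open import Relation.Nullary using (¬_; does)
open import Relation.Binary.PropositionalEquality using (_≡_; _≢_)

Matrix : ℕ → Set
Matrix n = Fin n → Fin n → ℕ

J : ∀ {n} → Matrix n
J x y = 1

I : ∀ {n} → Matrix n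
I x y = if does (x ≟ y) then 1 else 0

_⊕_ : ∀ {n} → Matrix n → Matrix n → Matrix n
(M ⊕ N) x y = M x y + N x y

-- entrywise subtraction (only applied where the result is nonnegative)
_⊖_ : ∀ {n} → Matrix n → Matrix n → Matrix n
(M ⊖ N) x y = M x y ∸ N x y

Σ : ∀ {n} → (Fin n → ℕ) → ℕ
Σ {n} f = sum (map f (allFin n))

IsTournament : ∀ {n} → Matrix n → Set
IsTournament {n} A =
  (∀ x y → A x y ≡ 0 ⊎ A x y ≡ 1) ×
  (∀ x → A x x ≡ 0) ×
  (∀ x y → x ≢ y → A x y + A y x ≡ 1)

outDeg inDeg : ∀ {n} → Matrix n → Fin n → ℕ
outDeg A x = Σ (λ y → A x y)
inDeg  A x = Σ (λ y → A y x)

commonOut commonIn : ∀ {n} → Matrix n → Fin n → Fin n → ℕ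
commonOut A x y = Σ (λ z → A x z * A y z)
commonIn  A x y = Σ (λ z → A z x * A z y)

-- doubly regular: in/out degree (n-1)/2, and (n-3)/4 common out- and in-neighbours
-- (the divisions are exact, written multiplicatively)
IsDoublyRegular : ∀ {n} → Matrix n → Set
IsDoublyRegular {n} A =
  IsTournament A ×
  (∀ x → 2 * outDeg A x + 1 ≡ n) ×
  (∀ x → 2 * inDeg A x + 1 ≡ n) ×
  (∀ x y → x ≢ y → 4 * commonOut A x y + 3 ≡ n) ×
  (∀ x y → x ≢ y → 4 * commonIn A x y + 3 ≡ n)

-- support of row x of M : the block of B_M indexed by x
rowSupport : ∀ {n} → Matrix n → Fin n → Subset n
rowSupport M x = tabulate (λ y → not (M x y ≡ᵇ 0))

-- B_M as a list of blocks (one per row, repetitions kept)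
blocksOf : ∀ {n} → Matrix n → List (Subset n)
blocksOf {n} M = map (rowSupport M) (allFin n)

occurrences : ∀ {n} → List (Subset n) → Subset n → ℕ
occurrences bs T = length (filter (λ B → T ⊆? B) bs)

IsDesign : ∀ {n} → ℕ → ℕ → ℕ → List (Subset n) → Set
IsDesign {n} t k l bs =
  All (λ B → ∣ B ∣ ≡ k) bs ×
  (∀ (T : Subset n) → ∣ T ∣ ≡ t → occurrences bs T ≡ l)

IsADesign : ∀ {n} → ℕ → ℕ → ℕ → List (Subset n) → Set
IsADesign {n} t k l bs =
  0 < l ×
  All (λ B → ∣ B ∣ ≡ k) bs ×
  (∀ (T : Subset n) → ∣ T ∣ ≡ t → occurrences bs T ≡ l ⊎ occurrences bs T ≡ suc l) ×
  ¬ (∃ λ μ → IsDesign t k μ bs)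

-- The blocks are the closed out-neighbourhoods {w} ∪ N⁺(w) and closed in-neighbourhoods
-- {w} ∪ N⁻(w). A point set lies in a block exactly when the product of the corresponding 0-1
-- entries is 1, so block counts are sums over w of products of adjacency columns shifted by the
-- identity, and these expand into degrees and common-neighbour counts. A pair {x, y} lies in
-- commonIn(x,y) + 1 out-blocks and commonOut(x,y) + 1 in-blocks, i.e. in (n + 1)/2 blocks.
-- For a triple, inclusion–exclusion over w shows that it lies in (n - 3)/4 blocks plus the
-- number of sources of the subtournament it spans: 1 for a transitive triple, 0 for a cyclic
-- one. When (n - 3)/4 > 0 both kinds of triple occur, so the triple counts take two values.
module Submission where

open import Defs
open import Data.Bool using (Bool; true; false; not; if_then_else_)
open import Data.Fin as Fin using (Fin; zero; suc)
open import Data.Fin.Properties using (_≟_; suc-injective)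
open import Data.Fin.Subset using (Subset; ∣_∣; _⊆_; _∈_; inside; outside)
open import Data.Fin.Subset.Properties using (_⊆?_; drop-there)
open import Data.List using (List; []; _∷_; map; allFin; _++_; length; filter)
open import Data.List.Properties
  using (map-tabulate; map-cong; map-∘; length-map; length-++; filter-++)
open import Data.List.Membership.Propositional using () renaming (_∈_ to _∈ₗ_)
open import Data.List.Membership.Propositional.Properties using (∈-map⁺; ∈-map⁻)
open import Data.List.Relation.Unary.All as All using (All; []; _∷_; all?)
import Data.List.Relation.Unary.All.Properties as All
open import Data.List.Relation.Unary.AllPairs using ([]; _∷_)
open import Data.List.Relation.Unary.Any using (here; there; any?)
open import Data.List.Relation.Unary.Unique.Propositional using (Unique)
import Data.List.Relation.Unary.Unique.Propositional.Properties as Unique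
open import Data.Nat using (ℕ; zero; suc; _+_; _*_; _∸_; _<_; _≡ᵇ_) renaming (_≟_ to _≟ℕ_)
open import Data.Nat.ListAction using (sum; product)
open import Data.Nat.Properties
  using (+-commutativeSemigroup; +-identityʳ; +-comm; *-identityʳ; *-zeroʳ;
         +-cancelˡ-≡; +-cancelʳ-≡; *-cancelˡ-≡; 0≢1+n; >⇒≢)
open import Algebra.Properties.CommutativeSemigroup +-commutativeSemigroup using (interchange)
open import Data.Nat.Tactic.RingSolver using (solve-∀)
open import Data.Product using (∃; ∃₂; _×_; _,_; proj₁; proj₂)
open import Data.Sum using (_⊎_; inj₁; inj₂)
open import Data.Vec using (tabulate; []; _∷_; here; there)
open import Data.Vec.Properties using (lookup∘tabulate; []=⇒lookup; lookup⇒[]=)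
open import Function using (_∘_; id; _⇔_; mk⇔; Equivalence)
open import Relation.Binary.PropositionalEquality
  using (_≡_; _≢_; _≗_; refl; sym; trans; cong; cong₂; subst; module ≡-Reasoning)
open import Relation.Nullary using (Dec; yes; no; does; ¬_; contradiction)
open import Relation.Nullary.Decidable using (¬?; dec-true; dec-false; does-⇔)
open import Relation.Unary using (Decidable)

open Equivalence using (to; from)
open ≡-Reasoning

𝟙[_] : ∀ {P : Set} → Dec P → ℕ
𝟙[ P? ] = if does P? then 1 else 0

Bit : ℕ → Set
Bit a = a ≡ 0 ⊎ a ≡ 1

Bit≢0⇒≡1 : ∀ {a} → Bit a → a ≢ 0 → a ≡ 1
Bit≢0⇒≡1 (inj₁ a≡0) a≢0 = contradiction a≡0 a≢0
Bit≢0⇒≡1 (inj₂ a≡1) _   = a≡1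

Bit*≢0⇒≡1 : ∀ {a b} → Bit a → Bit b → a * b ≢ 0 → a ≡ 1 × b ≡ 1
Bit*≢0⇒≡1 (inj₁ refl) _           ab≢0 = contradiction refl ab≢0
Bit*≢0⇒≡1 (inj₂ refl) (inj₁ refl) ab≢0 = contradiction refl ab≢0
Bit*≢0⇒≡1 (inj₂ refl) (inj₂ refl) _    = refl , refl

product-Bit : ∀ {ns} → All Bit ns → product ns ≡ 𝟙[ all? (_≟ℕ 1) ns ]
product-Bit []                 = refl
product-Bit (inj₁ refl ∷ _)    = refl
product-Bit (inj₂ refl ∷ bits) = trans (+-identityʳ _) (product-Bit bits)

sum-map-+ : ∀ {A : Set} (f g : A → ℕ) xs →
  sum (map (λ a → f a + g a) xs) ≡ sum (map f xs) + sum (map g xs)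
sum-map-+ f g []       = refl
sum-map-+ f g (x ∷ xs) =
  trans (cong (f x + g x +_) (sum-map-+ f g xs)) (interchange (f x) (g x) _ _)

length-filter≡sum : ∀ {A : Set} {P : A → Set} (P? : Decidable P) xs →
  length (filter P? xs) ≡ sum (map (λ x → 𝟙[ P? x ]) xs)
length-filter≡sum P? []       = refl
length-filter≡sum P? (x ∷ xs) with does (P? x)
... | true  = cong suc (length-filter≡sum P? xs)
... | false = length-filter≡sum P? xs

-- Sums over the vertex set

Σ-suc : ∀ {n} (f : Fin (suc n) → ℕ) → Σ f ≡ f zero + Σ (f ∘ suc)
Σ-suc f = cong (λ xs → f zero + sum xs)
  (trans (map-tabulate suc f) (sym (map-tabulate id (f ∘ suc))))

Σ-cong : ∀ {n} {f g : Fin n → ℕ} → f ≗ g → Σ f ≡ Σ g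
Σ-cong {n} f≗g = cong sum (map-cong f≗g (allFin n))

Σ-+ : ∀ {n} (f g : Fin n → ℕ) → Σ (λ w → f w + g w) ≡ Σ f + Σ g
Σ-+ f g = sum-map-+ f g (allFin _)

Σ-+₃ : ∀ {n} (f g h : Fin n → ℕ) → Σ (λ w → f w + g w + h w) ≡ Σ f + Σ g + Σ h
Σ-+₃ f g h = trans (Σ-+ (λ w → f w + g w) h) (cong (_+ Σ h) (Σ-+ f g))

Σ-const : ∀ n c → Σ {n} (λ _ → c) ≡ n * c
Σ-const zero    c = refl
Σ-const (suc n) c = trans (Σ-suc {n} (λ _ → c)) (cong (c +_) (Σ-const n c))

Σ-select : ∀ {n} (x : Fin n) (g : Fin n → ℕ) → Σ (λ w → I w x * g w) ≡ g x
Σ-select {suc n} zero g = begin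
  Σ (λ w → I w zero * g w)     ≡⟨ Σ-suc (λ w → I w zero * g w) ⟩
  g zero + 0 + Σ {n} (λ _ → 0) ≡⟨ cong₂ _+_ (+-identityʳ (g zero)) (Σ-const n 0) ⟩
  g zero + n * 0               ≡⟨ cong (g zero +_) (*-zeroʳ n) ⟩
  g zero + 0                   ≡⟨ +-identityʳ (g zero) ⟩
  g zero                       ∎
Σ-select {suc n} (suc x) g = trans (Σ-suc (λ w → I w (suc x) * g w)) (Σ-select x (g ∘ suc))

Σ≢0⇒∃≢0 : ∀ {n} (f : Fin n → ℕ) → Σ f ≢ 0 → ∃ λ w → f w ≢ 0
Σ≢0⇒∃≢0 {zero}  f Σf≢0 = contradiction refl Σf≢0
Σ≢0⇒∃≢0 {suc n} f Σf≢0 with f zero ≟ℕ 0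
... | no f0≢0  = zero , f0≢0
... | yes f0≡0 =
  let w , fw≢0 = Σ≢0⇒∃≢0 (f ∘ suc) (λ rest≡0 →
        Σf≢0 (trans (Σ-suc f) (cong₂ _+_ f0≡0 rest≡0)))
  in suc w , fw≢0

I-sym : ∀ {n} (x y : Fin n) → I x y ≡ I y x
I-sym zero    zero    = refl
I-sym zero    (suc y) = refl
I-sym (suc x) zero    = refl
I-sym (suc x) (suc y) = I-sym x y

I≢ : ∀ {n} {x y : Fin n} → x ≢ y → I x y ≡ 0
I≢ {x = x} {y} x≢y = cong (λ b → if b then 1 else 0) (dec-false (x ≟ y) x≢y)

+I≢ : ∀ {n} {x y : Fin n} a → x ≢ y → a + I x y ≡ a
+I≢ a x≢y = trans (cong (a +_) (I≢ x≢y)) (+-identityʳ a)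

I*I≢ : ∀ {n} (w : Fin n) {x y} → x ≢ y → I w x * I w y ≡ 0
I*I≢ w {x} {y} x≢y with w ≟ x
... | no _     = refl
... | yes refl = trans (+-identityʳ _) (I≢ x≢y)

Σ-I : ∀ {n} (x : Fin n) → Σ (λ w → I w x) ≡ 1
Σ-I x = trans (Σ-cong (λ w → sym (*-identityʳ (I w x)))) (Σ-select x (λ _ → 1))

Σ-+I : ∀ {n} (g : Fin n → ℕ) w → Σ (λ t → g t + I w t) ≡ Σ g + 1
Σ-+I g w = trans (Σ-+ g (I w)) (cong (Σ g +_) (trans (Σ-cong (I-sym w)) (Σ-I w)))

Σ-⊕I-pair : ∀ {n} (f : Fin n → Fin n → ℕ) {x y} → x ≢ y →
  Σ (λ w → product (map (λ p → f p w + I w p) (x ∷ y ∷ []))) ≡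
  Σ (λ w → f x w * f y w) + (f y x + f x y)
Σ-⊕I-pair f {x} {y} x≢y = begin
  Σ (λ w → product (map (λ p → f p w + I w p) (x ∷ y ∷ [])))
    ≡⟨ Σ-cong (λ w → expand (f x w) (f y w) (I w x) (I w y)) ⟩
  Σ (λ w → P w + (I w x * X w + I w y * f x w))
    ≡⟨ Σ-+ P (λ w → I w x * X w + I w y * f x w) ⟩
  Σ P + Σ (λ w → I w x * X w + I w y * f x w)
    ≡⟨ cong (Σ P +_) (Σ-+ (λ w → I w x * X w) (λ w → I w y * f x w)) ⟩
  Σ P + (Σ (λ w → I w x * X w) + Σ (λ w → I w y * f x w))
    ≡⟨ cong (Σ P +_) (cong₂ _+_ (Σ-select x X) (Σ-select y (f x))) ⟩
  Σ P + (f y x + I x y + f x y)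
    ≡⟨ cong (λ s → Σ P + (s + f x y)) (+I≢ (f y x) x≢y) ⟩
  Σ P + (f y x + f x y) ∎
  where
  P X : Fin _ → ℕ
  P w = f x w * f y w
  X w = f y w + I w y
  expand : ∀ a b d e → (a + d) * ((b + e) * 1) ≡ a * b + (d * (b + e) + e * a)
  expand = solve-∀

Σ-⊕I-triple : ∀ {n} (f : Fin n → Fin n → ℕ) {x y z} → x ≢ y → x ≢ z → y ≢ z →
  Σ (λ w → product (map (λ p → f p w + I w p) (x ∷ y ∷ z ∷ []))) ≡
  Σ (λ w → f x w * (f y w * f z w)) + (f y x * f z x + f x y * f z y + f x z * f y z)
Σ-⊕I-triple f {x} {y} {z} x≢y x≢z y≢z = begin
  Σ (λ w → product (map (λ p → f p w + I w p) (x ∷ y ∷ z ∷ [])))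
    ≡⟨ Σ-cong (λ w → expand (f x w) (f y w) (f z w) (I w x) (I w y) (I w z)) ⟩
  Σ (λ w → P w + (I w x * X w + I w y * Y w + I w z * Z w))
    ≡⟨ Σ-+ P (λ w → I w x * X w + I w y * Y w + I w z * Z w) ⟩
  Σ P + Σ (λ w → I w x * X w + I w y * Y w + I w z * Z w)
    ≡⟨ cong (Σ P +_) (Σ-+₃ (λ w → I w x * X w) (λ w → I w y * Y w) (λ w → I w z * Z w)) ⟩
  Σ P + (Σ (λ w → I w x * X w) + Σ (λ w → I w y * Y w) + Σ (λ w → I w z * Z w))
    ≡⟨ cong (Σ P +_) (cong₂ _+_ (cong₂ _+_ (Σ-select x X) (Σ-select y Y)) (Σ-select z Z)) ⟩
  Σ P + (X x + Y y + Z z)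
    ≡⟨ cong (λ s → Σ P + (s + Z z))
            (cong₂ _+_ (cong₂ _*_ (+I≢ (f y x) x≢y) (+I≢ (f z x) x≢z))
                       (cong (f x y *_) (+I≢ (f z y) y≢z))) ⟩
  Σ P + (f y x * f z x + f x y * f z y + f x z * f y z) ∎
  where
  P X Y Z : Fin _ → ℕ
  P w = f x w * (f y w * f z w)
  X w = (f y w + I w y) * (f z w + I w z)
  Y w = f x w * (f z w + I w z)
  Z w = f x w * f y w
  expand : ∀ a b c d e g → (a + d) * ((b + e) * ((c + g) * 1)) ≡
    a * (b * c) + (d * ((b + e) * (c + g)) + e * (a * (c + g)) + g * (a * b))
  expand = solve-∀

-- Finite subsets and lists of their elements

_Enumerates_ : ∀ {n} → List (Fin n) → Subset n → Set
ps Enumerates T = ∀ i → i ∈ T ⇔ i ∈ₗ ps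

∈-tabulate⇔ : ∀ {n} {P : Fin n → Set} (P? : Decidable P) i → i ∈ tabulate (does ∘ P?) ⇔ P i
∈-tabulate⇔ P? i = mk⇔
  (λ i∈ → does≡true⇒ (P? i) (trans (sym (lookup∘tabulate (does ∘ P?) i)) ([]=⇒lookup i∈)))
  (λ Pi → lookup⇒[]= i _ (trans (lookup∘tabulate (does ∘ P?) i) (dec-true (P? i) Pi)))
  where
  does≡true⇒ : ∀ {A : Set} (A? : Dec A) → does A? ≡ true → A
  does≡true⇒ (yes a) _ = a

∣tabulate∣ : ∀ {n} (g : Fin n → Bool) → ∣ tabulate g ∣ ≡ Σ (λ i → if g i then 1 else 0)
∣tabulate∣ {zero}  g = refl
∣tabulate∣ {suc n} g = begin
  ∣ g zero ∷ tabulate (g ∘ suc) ∣        ≡⟨ ∣∷∣ (g zero) (tabulate (g ∘ suc)) ⟩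
  𝟙 (g zero) + ∣ tabulate (g ∘ suc) ∣    ≡⟨ cong (𝟙 (g zero) +_) (∣tabulate∣ (g ∘ suc)) ⟩
  𝟙 (g zero) + Σ (λ i → 𝟙 (g (suc i)))  ≡⟨ Σ-suc (λ i → 𝟙 (g i)) ⟨
  Σ (λ i → 𝟙 (g i))                      ∎
  where
  𝟙 : Bool → ℕ
  𝟙 b = if b then 1 else 0
  ∣∷∣ : ∀ b (p : Subset n) → ∣ b ∷ p ∣ ≡ 𝟙 b + ∣ p ∣
  ∣∷∣ true  p = refl
  ∣∷∣ false p = refl

members : ∀ {n} → Subset n → List (Fin n)
members []            = []
members (inside  ∷ p) = zero ∷ map suc (members p)
members (outside ∷ p) = map suc (members p)

suc∈map-suc⇔ : ∀ {n} {i : Fin n} {ps} → suc i ∈ₗ map suc ps ⇔ i ∈ₗ ps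
suc∈map-suc⇔ = mk⇔
  (λ i∈ → let _ , j∈ , i≡j = ∈-map⁻ Fin.suc i∈ in subst (_∈ₗ _) (sym (suc-injective i≡j)) j∈)
  (∈-map⁺ Fin.suc)

zero∉map-suc : ∀ {n} {ps : List (Fin n)} → ¬ zero ∈ₗ map suc ps
zero∉map-suc 0∈ with ∈-map⁻ Fin.suc 0∈
... | _ , _ , ()

members-enumerates : ∀ {n} (p : Subset n) → members p Enumerates p
members-enumerates (inside  ∷ p) zero    = mk⇔ (λ _ → here refl) (λ _ → here)
members-enumerates (outside ∷ p) zero    = mk⇔ (λ ()) (λ 0∈ → contradiction 0∈ zero∉map-suc)
members-enumerates (inside  ∷ p) (suc i) = mk⇔
  (λ i∈ → there (from suc∈map-suc⇔ (to (members-enumerates p i) (drop-there i∈))))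
  (λ { (here ()) ; (there i∈) → there (from (members-enumerates p i) (to suc∈map-suc⇔ i∈)) })
members-enumerates (outside ∷ p) (suc i) = mk⇔
  (λ i∈ → from suc∈map-suc⇔ (to (members-enumerates p i) (drop-there i∈)))
  (λ i∈ → there (from (members-enumerates p i) (to suc∈map-suc⇔ i∈)))

length-members : ∀ {n} (p : Subset n) → length (members p) ≡ ∣ p ∣
length-members []            = refl
length-members (inside  ∷ p) = cong suc (trans (length-map suc (members p)) (length-members p))
length-members (outside ∷ p) = trans (length-map suc (members p)) (length-members p)

members-unique : ∀ {n} (p : Subset n) → Unique (members p)
members-unique []            = []
members-unique (inside  ∷ p) =
  All.map⁺ (All.universal (λ _ ()) (members p)) ∷ Unique.map⁺ suc-injective (members-unique p)
members-unique (outside ∷ p) = Unique.map⁺ suc-injective (members-unique p)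

∣p∣≡2⇒pair : ∀ {n} (T : Subset n) → ∣ T ∣ ≡ 2 →
  ∃₂ λ x y → x ≢ y × (x ∷ y ∷ []) Enumerates T
∣p∣≡2⇒pair T ∣T∣≡2
  with members T | members-enumerates T | members-unique T | trans (length-members T) ∣T∣≡2
... | []            | _    | _              | ()
... | _ ∷ []        | _    | _              | ()
... | x ∷ y ∷ []    | enum | (x≢y ∷ []) ∷ _ | _  = x , y , x≢y , enum
... | _ ∷ _ ∷ _ ∷ _ | _    | _              | ()

∣p∣≡3⇒triple : ∀ {n} (T : Subset n) → ∣ T ∣ ≡ 3 →
  ∃₂ λ x y → ∃ λ z → x ≢ y × x ≢ z × y ≢ z × (x ∷ y ∷ z ∷ []) Enumerates T
∣p∣≡3⇒triple T ∣T∣≡3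
  with members T | members-enumerates T | members-unique T | trans (length-members T) ∣T∣≡3
... | []                | _    | _                                | ()
... | _ ∷ []            | _    | _                                | ()
... | _ ∷ _ ∷ []        | _    | _                                | ()
... | x ∷ y ∷ z ∷ []    | enum | (x≢y ∷ x≢z ∷ []) ∷ (y≢z ∷ []) ∷ _ | _ =
  x , y , z , x≢y , x≢z , y≢z , enum
... | _ ∷ _ ∷ _ ∷ _ ∷ _ | _    | _                                | ()

fromList : ∀ {n} → List (Fin n) → Subset n
fromList ps = tabulate (λ i → does (any? (i ≟_) ps))

fromList-enumerates : ∀ {n} (ps : List (Fin n)) → ps Enumerates fromList ps
fromList-enumerates ps = ∈-tabulate⇔ (λ i → any? (i ≟_) ps)

∣fromList∣ : ∀ {n} {ps : List (Fin n)} → Unique ps → ∣ fromList ps ∣ ≡ length ps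
∣fromList∣ {n} {ps} unique = trans (∣tabulate∣ (λ i → does (any? (i ≟_) ps))) (Σ-𝟙∈ unique)
  where
  Σ-𝟙∈ : ∀ {qs} → Unique qs → Σ (λ i → 𝟙[ any? (i ≟_) qs ]) ≡ length qs
  Σ-𝟙∈ {[]}     []           = trans (Σ-const n 0) (*-zeroʳ n)
  Σ-𝟙∈ {q ∷ qs} (q∉qs ∷ uqs) = begin
    Σ (λ i → 𝟙[ any? (i ≟_) (q ∷ qs) ])
      ≡⟨ Σ-cong 𝟙∈∷ ⟩
    Σ (λ i → I i q + 𝟙[ any? (i ≟_) qs ])
      ≡⟨ Σ-+ (λ i → I i q) (λ i → 𝟙[ any? (i ≟_) qs ]) ⟩
    Σ (λ i → I i q) + Σ (λ i → 𝟙[ any? (i ≟_) qs ])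
      ≡⟨ cong₂ _+_ (Σ-I q) (Σ-𝟙∈ uqs) ⟩
    suc (length qs) ∎
    where
    𝟙∈∷ : ∀ i → 𝟙[ any? (i ≟_) (q ∷ qs) ] ≡ I i q + 𝟙[ any? (i ≟_) qs ]
    𝟙∈∷ i with i ≟ q
    ... | no _     = refl
    ... | yes refl = cong (λ b → suc (if b then 1 else 0))
                          (sym (dec-false (any? (i ≟_) qs) (All.All¬⇒¬Any q∉qs)))

-- Counting blocks

∈-rowSupport⇔ : ∀ {n} (M : Matrix n) w i → i ∈ rowSupport M w ⇔ M w i ≢ 0
∈-rowSupport⇔ M w = ∈-tabulate⇔ (λ i → ¬? (M w i ≟ℕ 0))

∣rowSupport∣ : ∀ {n} (M : Matrix n) w → (∀ t → Bit (M w t)) → ∣ rowSupport M w ∣ ≡ Σ (M w)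
∣rowSupport∣ M w bit =
  trans (∣tabulate∣ (λ t → not (M w t ≡ᵇ 0))) (Σ-cong (λ t → 𝟙≢0 (bit t)))
  where
  𝟙≢0 : ∀ {a} → Bit a → (if not (a ≡ᵇ 0) then 1 else 0) ≡ a
  𝟙≢0 (inj₁ refl) = refl
  𝟙≢0 (inj₂ refl) = refl

⊆rowSupport⇔ : ∀ {n} (M : Matrix n) w → (∀ t → Bit (M w t)) → ∀ {ps T} → ps Enumerates T →
  T ⊆ rowSupport M w ⇔ All (_≡ 1) (map (M w) ps)
⊆rowSupport⇔ M w bit enum = mk⇔
  (λ T⊆ → All.map⁺ (All.tabulate (λ {p} p∈ →
     Bit≢0⇒≡1 (bit p) (to (∈-rowSupport⇔ M w p) (T⊆ (from (enum p) p∈))))))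
  (λ all≡1 {i} i∈ → from (∈-rowSupport⇔ M w i)
     (λ Mwi≡0 → 0≢1+n (trans (sym Mwi≡0) (All.lookup (All.map⁻ all≡1) (to (enum i) i∈)))))

𝟙⊆rowSupport : ∀ {n} (M : Matrix n) w → (∀ t → Bit (M w t)) → ∀ {ps T} → ps Enumerates T →
  𝟙[ T ⊆? rowSupport M w ] ≡ product (map (M w) ps)
𝟙⊆rowSupport M w bit {ps} {T} enum = begin
  𝟙[ T ⊆? rowSupport M w ]
    ≡⟨ cong (λ b → if b then 1 else 0)
            (does-⇔ (⊆rowSupport⇔ M w bit enum)
                    (T ⊆? rowSupport M w) (all? (_≟ℕ 1) (map (M w) ps))) ⟩
  𝟙[ all? (_≟ℕ 1) (map (M w) ps) ]
    ≡⟨ product-Bit (All.map⁺ (All.universal bit ps)) ⟨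
  product (map (M w) ps) ∎

occurrences-++ : ∀ {n} (bs cs : List (Subset n)) T →
  occurrences (bs ++ cs) T ≡ occurrences bs T + occurrences cs T
occurrences-++ bs cs T =
  trans (cong length (filter-++ (T ⊆?_) bs cs)) (length-++ (filter (T ⊆?_) bs))

occurrences-blocksOf : ∀ {n} (M : Matrix n) → (∀ w t → Bit (M w t)) → ∀ {ps T} →
  ps Enumerates T → occurrences (blocksOf M) T ≡ Σ (λ w → product (map (M w) ps))
occurrences-blocksOf {n} M bit {ps} {T} enum = begin
  occurrences (blocksOf M) T
    ≡⟨ length-filter≡sum (T ⊆?_) (blocksOf M) ⟩
  sum (map (λ B → 𝟙[ T ⊆? B ]) (map (rowSupport M) (allFin n)))
    ≡⟨ cong sum (map-∘ (allFin n)) ⟨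
  Σ (λ w → 𝟙[ T ⊆? rowSupport M w ])
    ≡⟨ Σ-cong (λ w → 𝟙⊆rowSupport M w (bit w) enum) ⟩
  Σ (λ w → product (map (M w) ps)) ∎

-- Tournaments

data Arc : ℕ → ℕ → Set where
  forward  : Arc 1 0
  backward : Arc 0 1

data ExactlyOne : ℕ → ℕ → ℕ → Set where
  first  : ExactlyOne 1 0 0
  second : ExactlyOne 0 1 0
  third  : ExactlyOne 0 0 1

Bit+≡1⇒Arc : ∀ {a b} → Bit a → a + b ≡ 1 → Arc a b
Bit+≡1⇒Arc (inj₁ refl) refl = backward
Bit+≡1⇒Arc (inj₂ refl) refl = forward

Arc⇒ExactlyOne : ∀ {a b} → Arc a b → ExactlyOne a b 0
Arc⇒ExactlyOne forward  = first
Arc⇒ExactlyOne backward = second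

ExactlyOne-Bit₁₃ : ∀ {a b c} → ExactlyOne a b c → Bit (a + c)
ExactlyOne-Bit₁₃ first  = inj₂ refl
ExactlyOne-Bit₁₃ second = inj₁ refl
ExactlyOne-Bit₁₃ third  = inj₂ refl

ExactlyOne-Bit₂₃ : ∀ {a b c} → ExactlyOne a b c → Bit (b + c)
ExactlyOne-Bit₂₃ first  = inj₁ refl
ExactlyOne-Bit₂₃ second = inj₂ refl
ExactlyOne-Bit₂₃ third  = inj₂ refl

ExactlyOne-complement : ∀ {a b c} → ExactlyOne a b c → 1 ∸ c ∸ a + c ≡ b + c
ExactlyOne-complement first  = refl
ExactlyOne-complement second = refl
ExactlyOne-complement third  = refl

ExactlyOne-split : ∀ {a b c} → ExactlyOne a b c → ∀ v → v ≡ v * a + b * v + c * v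
ExactlyOne-split first  = solve-∀
ExactlyOne-split second = solve-∀
ExactlyOne-split third  = solve-∀

Arc³-sources-Bit : ∀ {p p′ q q′ r r′} → Arc p p′ → Arc r r′ → Arc q q′ →
  Bit (p * r + p′ * q + r′ * q′)
Arc³-sources-Bit forward  forward  forward  = inj₂ refl
Arc³-sources-Bit forward  forward  backward = inj₂ refl
Arc³-sources-Bit forward  backward forward  = inj₁ refl
Arc³-sources-Bit forward  backward backward = inj₂ refl
Arc³-sources-Bit backward forward  forward  = inj₂ refl
Arc³-sources-Bit backward forward  backward = inj₁ refl
Arc³-sources-Bit backward backward forward  = inj₂ refl
Arc³-sources-Bit backward backward backward = inj₂ refl

-- Inclusion–exclusion at one vertex w: a, b, c record whether w beats x, y, z, a′, b′, c′
-- whether it is beaten by them, and d, e, f whether it equals them. For w ∉ {x, y, z} this is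
-- [w beats all] + [w is beaten by all] = 1 - (a + b + c) + (ab + bc + ca).
in-out-identity : ∀ {a a′ d b b′ e c c′ f} →
  ExactlyOne a a′ d → ExactlyOne b b′ e → ExactlyOne c c′ f →
  d * e ≡ 0 → d * f ≡ 0 → e * f ≡ 0 →
  a * (b * c) + a′ * (b′ * c′) + (a + b + c) + (d * (b′ * c′) + e * (a′ * c′) + f * (a′ * b′))
    ≡ 1 + (a * b + b * c + c * a)
in-out-identity first  first  first  _  _  _  = refl
in-out-identity first  first  second _  _  _  = refl
in-out-identity first  first  third  _  _  _  = refl
in-out-identity first  second first  _  _  _  = refl
in-out-identity first  second second _  _  _  = refl
in-out-identity first  second third  _  _  _  = refl
in-out-identity first  third  first  _  _  _  = refl
in-out-identity first  third  second _  _  _  = refl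
in-out-identity first  third  third  _  _  ()
in-out-identity second first  first  _  _  _  = refl
in-out-identity second first  second _  _  _  = refl
in-out-identity second first  third  _  _  _  = refl
in-out-identity second second first  _  _  _  = refl
in-out-identity second second second _  _  _  = refl
in-out-identity second second third  _  _  _  = refl
in-out-identity second third  first  _  _  _  = refl
in-out-identity second third  second _  _  _  = refl
in-out-identity second third  third  _  _  ()
in-out-identity third  first  first  _  _  _  = refl
in-out-identity third  first  second _  _  _  = refl
in-out-identity third  first  third  _  () _
in-out-identity third  second first  _  _  _  = refl
in-out-identity third  second second _  _  _  = refl
in-out-identity third  second third  _  () _
in-out-identity third  third  _      () _  _

module Tournament {n} (A : Matrix n) (tournament : IsTournament A) where

  bit : ∀ x y → Bit (A x y)
  bit = proj₁ tournament

  irreflexive : ∀ x → A x x ≡ 0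
  irreflexive = proj₁ (proj₂ tournament)

  complete : ∀ x y → x ≢ y → A x y + A y x ≡ 1
  complete = proj₂ (proj₂ tournament)

  A′ : Matrix n
  A′ = (J ⊖ I) ⊖ A

  blocks : List (Subset n)
  blocks = blocksOf (A ⊕ I) ++ blocksOf (A′ ⊕ I)

  sourceCount sinkCount : Fin n → Fin n → Fin n → ℕ
  sourceCount x y z = A x y * A x z + A y x * A y z + A z x * A z y
  sinkCount   x y z = A y x * A z x + A x y * A z y + A x z * A y z

  arc : ∀ {x y} → x ≢ y → Arc (A x y) (A y x)
  arc {x} {y} x≢y = Bit+≡1⇒Arc (bit x y) (complete x y x≢y)

  arc⇒≢ : ∀ {x y} → A x y ≡ 1 → x ≢ y
  arc⇒≢ {x} Axy≡1 refl = 0≢1+n (trans (sym (irreflexive x)) Axy≡1)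

  arc⇒reverse≡0 : ∀ {x y} → A x y ≡ 1 → A y x ≡ 0
  arc⇒reverse≡0 {x} {y} Axy≡1 =
    +-cancelˡ-≡ 1 (A y x) 0 (trans (cong (_+ A y x) (sym Axy≡1)) (complete x y (arc⇒≢ Axy≡1)))

  trichotomy : ∀ w t → ExactlyOne (A w t) (A t w) (I w t)
  trichotomy w t with w ≟ t
  ... | yes refl = subst (λ a → ExactlyOne a a 1) (sym (irreflexive w)) third
  ... | no w≢t   = Arc⇒ExactlyOne (arc w≢t)

  A′⊕I≡Aᵀ⊕I : ∀ w t → (A′ ⊕ I) w t ≡ A t w + I w t
  A′⊕I≡Aᵀ⊕I w t = ExactlyOne-complement (trichotomy w t)

  out-Bit : ∀ w t → Bit ((A ⊕ I) w t)
  out-Bit w t = ExactlyOne-Bit₁₃ (trichotomy w t)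

  in-Bit : ∀ w t → Bit ((A′ ⊕ I) w t)
  in-Bit w t = subst Bit (sym (A′⊕I≡Aᵀ⊕I w t)) (ExactlyOne-Bit₂₃ (trichotomy w t))

  occurrences-blocks : ∀ {ps T} → ps Enumerates T →
    occurrences blocks T ≡
    Σ (λ w → product (map (λ p → A w p + I w p) ps)) +
    Σ (λ w → product (map (λ p → A p w + I w p) ps))
  occurrences-blocks {ps} {T} enum = begin
    occurrences blocks T
      ≡⟨ occurrences-++ (blocksOf (A ⊕ I)) (blocksOf (A′ ⊕ I)) T ⟩
    occurrences (blocksOf (A ⊕ I)) T + occurrences (blocksOf (A′ ⊕ I)) T
      ≡⟨ cong₂ _+_ (occurrences-blocksOf (A ⊕ I) out-Bit enum)
                   (occurrences-blocksOf (A′ ⊕ I) in-Bit enum) ⟩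
    Σ (λ w → product (map ((A ⊕ I) w) ps)) + Σ (λ w → product (map ((A′ ⊕ I) w) ps))
      ≡⟨ cong (Σ (λ w → product (map ((A ⊕ I) w) ps)) +_)
              (Σ-cong (λ w → cong product (map-cong (A′⊕I≡Aᵀ⊕I w) ps))) ⟩
    Σ (λ w → product (map (λ p → A w p + I w p) ps)) +
    Σ (λ w → product (map (λ p → A p w + I w p) ps)) ∎

  occurrences-pair : ∀ {x y T} → x ≢ y → (x ∷ y ∷ []) Enumerates T →
    occurrences blocks T ≡ (commonIn A x y + 1) + (commonOut A x y + 1)
  occurrences-pair {x} {y} {T} x≢y enum = begin
    occurrences blocks T
      ≡⟨ occurrences-blocks enum ⟩
    Σ (λ w → product (map (λ p → A w p + I w p) (x ∷ y ∷ []))) +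
    Σ (λ w → product (map (λ p → A p w + I w p) (x ∷ y ∷ [])))
      ≡⟨ cong₂ _+_ (Σ-⊕I-pair (λ p w → A w p) x≢y) (Σ-⊕I-pair (λ p w → A p w) x≢y) ⟩
    (commonIn A x y + (A x y + A y x)) + (commonOut A x y + (A y x + A x y))
      ≡⟨ cong₂ (λ s t → (commonIn A x y + s) + (commonOut A x y + t))
               (complete x y x≢y) (complete y x (x≢y ∘ sym)) ⟩
    (commonIn A x y + 1) + (commonOut A x y + 1) ∎

  in-out-count : ∀ {x y z} → x ≢ y → x ≢ z → y ≢ z →
    Σ (λ w → A w x * (A w y * A w z)) + Σ (λ w → A x w * (A y w * A z w))
      + (inDeg A x + inDeg A y + inDeg A z) + sinkCount x y z
    ≡ n + (commonIn A x y + commonIn A y z + commonIn A z x)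
  in-out-count {x} {y} {z} x≢y x≢z y≢z = begin
    Σ P + Σ Q + (inDeg A x + inDeg A y + inDeg A z) + sinkCount x y z
      ≡⟨ cong₂ (λ s t → s + (inDeg A x + inDeg A y + inDeg A z) + t) (Σ-+ P Q) Σδ≡sinkCount ⟨
    Σ (λ w → P w + Q w) + (inDeg A x + inDeg A y + inDeg A z) + Σ δ
      ≡⟨ cong (λ s → Σ (λ w → P w + Q w) + s + Σ δ)
              (Σ-+₃ (λ w → A w x) (λ w → A w y) (λ w → A w z)) ⟨
    Σ (λ w → P w + Q w) + Σ (λ w → A w x + A w y + A w z) + Σ δ
      ≡⟨ Σ-+₃ (λ w → P w + Q w) (λ w → A w x + A w y + A w z) δ ⟨
    Σ (λ w → P w + Q w + (A w x + A w y + A w z) + δ w)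
      ≡⟨ Σ-cong (λ w → in-out-identity (trichotomy w x) (trichotomy w y) (trichotomy w z)
                                       (I*I≢ w x≢y) (I*I≢ w x≢z) (I*I≢ w y≢z)) ⟩
    Σ (λ w → 1 + (A w x * A w y + A w y * A w z + A w z * A w x))
      ≡⟨ Σ-+ (λ _ → 1) (λ w → A w x * A w y + A w y * A w z + A w z * A w x) ⟩
    Σ {n} (λ _ → 1) + Σ (λ w → A w x * A w y + A w y * A w z + A w z * A w x)
      ≡⟨ cong₂ _+_ (trans (Σ-const n 1) (*-identityʳ n))
                   (Σ-+₃ (λ w → A w x * A w y) (λ w → A w y * A w z) (λ w → A w z * A w x)) ⟩
    n + (commonIn A x y + commonIn A y z + commonIn A z x) ∎
    where
    P Q δ : Fin n → ℕ
    P w = A w x * (A w y * A w z)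
    Q w = A x w * (A y w * A z w)
    δ w = I w x * (A y w * A z w) + I w y * (A x w * A z w) + I w z * (A x w * A y w)
    Σδ≡sinkCount : Σ δ ≡ sinkCount x y z
    Σδ≡sinkCount = begin
      Σ δ
        ≡⟨ Σ-+₃ (λ w → I w x * (A y w * A z w)) (λ w → I w y * (A x w * A z w))
                (λ w → I w z * (A x w * A y w)) ⟩
      Σ (λ w → I w x * (A y w * A z w)) + Σ (λ w → I w y * (A x w * A z w))
        + Σ (λ w → I w z * (A x w * A y w))
        ≡⟨ cong₂ _+_ (cong₂ _+_ (Σ-select x (λ w → A y w * A z w))
                                (Σ-select y (λ w → A x w * A z w)))
                     (Σ-select z (λ w → A x w * A y w)) ⟩
      sinkCount x y z ∎

  occurrences-triple : ∀ {x y z T} → x ≢ y → x ≢ z → y ≢ z →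
    (x ∷ y ∷ z ∷ []) Enumerates T →
    occurrences blocks T + (inDeg A x + inDeg A y + inDeg A z)
    ≡ n + (commonIn A x y + commonIn A y z + commonIn A z x) + sourceCount x y z
  occurrences-triple {x} {y} {z} {T} x≢y x≢z y≢z enum = begin
    occurrences blocks T + D
      ≡⟨ cong (_+ D) (trans (occurrences-blocks enum)
                            (cong₂ _+_ (Σ-⊕I-triple (λ p w → A w p) x≢y x≢z y≢z)
                                       (Σ-⊕I-triple (λ p w → A p w) x≢y x≢z y≢z))) ⟩
    (Σ P + sourceCount x y z) + (Σ Q + sinkCount x y z) + D
      ≡⟨ rearrange (Σ P) (sourceCount x y z) (Σ Q) (sinkCount x y z) D ⟩
    Σ P + Σ Q + D + sinkCount x y z + sourceCount x y z
      ≡⟨ cong (_+ sourceCount x y z) (in-out-count x≢y x≢z y≢z) ⟩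
    n + (commonIn A x y + commonIn A y z + commonIn A z x) + sourceCount x y z ∎
    where
    D : ℕ
    D = inDeg A x + inDeg A y + inDeg A z
    P Q : Fin n → ℕ
    P w = A w x * (A w y * A w z)
    Q w = A x w * (A y w * A z w)
    rearrange : ∀ a b c d e → (a + b) + (c + d) + e ≡ a + c + e + d + b
    rearrange = solve-∀

  sourceCount-Bit : ∀ {x y z} → x ≢ y → x ≢ z → y ≢ z → Bit (sourceCount x y z)
  sourceCount-Bit x≢y x≢z y≢z = Arc³-sources-Bit (arc x≢y) (arc x≢z) (arc y≢z)

  beats-both⇒sourceCount≡1 : ∀ {x y z} → A x y ≡ 1 → A x z ≡ 1 → sourceCount x y z ≡ 1
  beats-both⇒sourceCount≡1 xy xz
    rewrite xy | xz | arc⇒reverse≡0 xy | arc⇒reverse≡0 xz = refl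

  cyclic⇒sourceCount≡0 : ∀ {x y z} → A x y ≡ 1 → A y z ≡ 1 → A z x ≡ 1 →
    sourceCount x y z ≡ 0
  cyclic⇒sourceCount≡0 xy yz zx
    rewrite xy | yz | zx | arc⇒reverse≡0 xy | arc⇒reverse≡0 yz | arc⇒reverse≡0 zx = refl

  outDeg≡returns+commonOut : ∀ x y →
    outDeg A y ≡ Σ (λ t → A y t * A t x) + commonOut A x y + A y x
  outDeg≡returns+commonOut x y = begin
    outDeg A y
      ≡⟨ Σ-cong (λ t → ExactlyOne-split (trichotomy t x) (A y t)) ⟩
    Σ (λ t → A y t * A t x + A x t * A y t + I t x * A y t)
      ≡⟨ Σ-+₃ (λ t → A y t * A t x) (λ t → A x t * A y t) (λ t → I t x * A y t) ⟩
    Σ (λ t → A y t * A t x) + commonOut A x y + Σ (λ t → I t x * A y t)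
      ≡⟨ cong (Σ (λ t → A y t * A t x) + commonOut A x y +_) (Σ-select x (A y)) ⟩
    Σ (λ t → A y t * A t x) + commonOut A x y + A y x ∎

-- Doubly regular tournaments

≡+Bit⇒≡⊎≡suc : ∀ {m l s} → Bit s → m ≡ l + s → m ≡ l ⊎ m ≡ suc l
≡+Bit⇒≡⊎≡suc {l = l} (inj₁ refl) m≡l+0 = inj₁ (trans m≡l+0 (+-identityʳ l))
≡+Bit⇒≡⊎≡suc {l = l} (inj₂ refl) m≡l+1 = inj₂ (trans m≡l+1 (+-comm l 1))

2m+1≡4l+3⇒m≡2l+1 : ∀ {m} l → 2 * m + 1 ≡ 4 * l + 3 → m ≡ 2 * l + 1
2m+1≡4l+3⇒m≡2l+1 {m} l eq =
  *-cancelˡ-≡ m (2 * l + 1) 2 (+-cancelʳ-≡ 1 (2 * m) (2 * (2 * l + 1)) (trans eq (4l+3≡ l)))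
  where
  4l+3≡ : ∀ l → 4 * l + 3 ≡ 2 * (2 * l + 1) + 1
  4l+3≡ = solve-∀

4m+3≡4l+3⇒m≡l : ∀ {m l} → 4 * m + 3 ≡ 4 * l + 3 → m ≡ l
4m+3≡4l+3⇒m≡l {m} {l} eq = *-cancelˡ-≡ m l 4 (+-cancelʳ-≡ 3 (4 * m) (4 * l) eq)

module DoublyRegular {n} (A : Matrix n) (doublyRegular : IsDoublyRegular A) where

  open Tournament A (proj₁ doublyRegular) public

  outRegular : ∀ x → 2 * outDeg A x + 1 ≡ n
  outRegular = proj₁ (proj₂ doublyRegular)

  inRegular : ∀ x → 2 * inDeg A x + 1 ≡ n
  inRegular = proj₁ (proj₂ (proj₂ doublyRegular))

  commonOutRegular : ∀ x y → x ≢ y → 4 * commonOut A x y + 3 ≡ n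
  commonOutRegular = proj₁ (proj₂ (proj₂ (proj₂ doublyRegular)))

  commonInRegular : ∀ x y → x ≢ y → 4 * commonIn A x y + 3 ≡ n
  commonInRegular = proj₂ (proj₂ (proj₂ (proj₂ doublyRegular)))

  block-sizes : ∀ {k} → 2 * k ≡ n + 1 → All (λ B → ∣ B ∣ ≡ k) blocks
  block-sizes {k} 2k≡n+1 =
    All.++⁺ (All.map⁺ (All.universal out-size (allFin n)))
            (All.map⁺ (All.universal in-size (allFin n)))
    where
    halve : ∀ {d} → 2 * d + 1 ≡ n → d + 1 ≡ k
    halve {d} 2d+1≡n =
      *-cancelˡ-≡ (d + 1) k 2 (trans (double d) (trans (cong (_+ 1) 2d+1≡n) (sym 2k≡n+1)))
      where
      double : ∀ d → 2 * (d + 1) ≡ 2 * d + 1 + 1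
      double = solve-∀
    out-size : ∀ w → ∣ rowSupport (A ⊕ I) w ∣ ≡ k
    out-size w = begin
      ∣ rowSupport (A ⊕ I) w ∣ ≡⟨ ∣rowSupport∣ (A ⊕ I) w (out-Bit w) ⟩
      Σ (λ t → A w t + I w t)  ≡⟨ Σ-+I (A w) w ⟩
      outDeg A w + 1           ≡⟨ halve (outRegular w) ⟩
      k                        ∎
    in-size : ∀ w → ∣ rowSupport (A′ ⊕ I) w ∣ ≡ k
    in-size w = begin
      ∣ rowSupport (A′ ⊕ I) w ∣ ≡⟨ ∣rowSupport∣ (A′ ⊕ I) w (in-Bit w) ⟩
      Σ ((A′ ⊕ I) w)            ≡⟨ Σ-cong (A′⊕I≡Aᵀ⊕I w) ⟩
      Σ (λ t → A t w + I w t)   ≡⟨ Σ-+I (λ t → A t w) w ⟩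
      inDeg A w + 1             ≡⟨ halve (inRegular w) ⟩
      k                         ∎

  pair-count : ∀ {k} → 2 * k ≡ n + 1 → ∀ T → ∣ T ∣ ≡ 2 → occurrences blocks T ≡ k
  pair-count {k} 2k≡n+1 T ∣T∣≡2 =
    let x , y , x≢y , enum = ∣p∣≡2⇒pair T ∣T∣≡2
        c = commonIn A x y
    in begin
      occurrences blocks T
        ≡⟨ occurrences-pair x≢y enum ⟩
      (c + 1) + (commonOut A x y + 1)
        ≡⟨ cong (λ c′ → (c + 1) + (c′ + 1))
                (4m+3≡4l+3⇒m≡l (trans (commonOutRegular x y x≢y) (sym (commonInRegular x y x≢y)))) ⟩
      (c + 1) + (c + 1)
        ≡⟨ *-cancelˡ-≡ ((c + 1) + (c + 1)) k 2
             (trans (double c) (trans (cong (_+ 1) (commonInRegular x y x≢y)) (sym 2k≡n+1))) ⟩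
      k ∎
    where
    double : ∀ c → 2 * ((c + 1) + (c + 1)) ≡ 4 * c + 3 + 1
    double = solve-∀

  module _ {l} (4l+3≡n : 4 * l + 3 ≡ n) where

    outDeg≡ : ∀ x → outDeg A x ≡ 2 * l + 1
    outDeg≡ x = 2m+1≡4l+3⇒m≡2l+1 l (trans (outRegular x) (sym 4l+3≡n))

    inDeg≡ : ∀ x → inDeg A x ≡ 2 * l + 1
    inDeg≡ x = 2m+1≡4l+3⇒m≡2l+1 l (trans (inRegular x) (sym 4l+3≡n))

    commonOut≡ : ∀ {x y} → x ≢ y → commonOut A x y ≡ l
    commonOut≡ {x} {y} x≢y = 4m+3≡4l+3⇒m≡l (trans (commonOutRegular x y x≢y) (sym 4l+3≡n))

    commonIn≡ : ∀ {x y} → x ≢ y → commonIn A x y ≡ l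
    commonIn≡ {x} {y} x≢y = 4m+3≡4l+3⇒m≡l (trans (commonInRegular x y x≢y) (sym 4l+3≡n))

    occurrences-triple≡ : ∀ {x y z T} → x ≢ y → x ≢ z → y ≢ z →
      (x ∷ y ∷ z ∷ []) Enumerates T → occurrences blocks T ≡ l + sourceCount x y z
    occurrences-triple≡ {x} {y} {z} {T} x≢y x≢z y≢z enum =
      +-cancelʳ-≡ (inDeg A x + inDeg A y + inDeg A z) (occurrences blocks T) (l + s) (begin
        occurrences blocks T + (inDeg A x + inDeg A y + inDeg A z)
          ≡⟨ occurrences-triple x≢y x≢z y≢z enum ⟩
        n + (commonIn A x y + commonIn A y z + commonIn A z x) + s
          ≡⟨ cong₂ (λ m c → m + c + s) (sym 4l+3≡n)
                   (cong₂ _+_ (cong₂ _+_ (commonIn≡ x≢y) (commonIn≡ y≢z))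
                              (commonIn≡ (x≢z ∘ sym))) ⟩
        4 * l + 3 + (l + l + l) + s
          ≡⟨ rearrange l s ⟩
        l + s + ((2 * l + 1) + (2 * l + 1) + (2 * l + 1))
          ≡⟨ cong (l + s +_) (cong₂ _+_ (cong₂ _+_ (inDeg≡ x) (inDeg≡ y)) (inDeg≡ z)) ⟨
        l + s + (inDeg A x + inDeg A y + inDeg A z) ∎)
      where
      s : ℕ
      s = sourceCount x y z
      rearrange : ∀ l s →
        4 * l + 3 + (l + l + l) + s ≡ l + s + ((2 * l + 1) + (2 * l + 1) + (2 * l + 1))
      rearrange = solve-∀

    triple-count : ∀ T → ∣ T ∣ ≡ 3 → occurrences blocks T ≡ l ⊎ occurrences blocks T ≡ suc l
    triple-count T ∣T∣≡3 =
      let x , y , z , x≢y , x≢z , y≢z , enum = ∣p∣≡3⇒triple T ∣T∣≡3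
      in ≡+Bit⇒≡⊎≡suc (sourceCount-Bit x≢y x≢z y≢z) (occurrences-triple≡ x≢y x≢z y≢z enum)

    triangle : ∀ {x y z s} → x ≢ y → x ≢ z → y ≢ z → sourceCount x y z ≡ s →
      ∃ λ T → ∣ T ∣ ≡ 3 × occurrences blocks T ≡ l + s
    triangle {x} {y} {z} x≢y x≢z y≢z sourceCount≡s =
      fromList (x ∷ y ∷ z ∷ []) ,
      ∣fromList∣ ((x≢y ∷ x≢z ∷ []) ∷ (y≢z ∷ []) ∷ [] ∷ []) ,
      trans (occurrences-triple≡ x≢y x≢z y≢z (fromList-enumerates (x ∷ y ∷ z ∷ [])))
            (cong (l +_) sourceCount≡s)

    vertex : Fin n
    vertex = subst Fin (trans (+-comm 3 (4 * l)) 4l+3≡n) zero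

    out-neighbour : ∀ x → ∃ λ y → A x y ≡ 1
    out-neighbour x =
      let y , Axy≢0 = Σ≢0⇒∃≢0 (A x) (λ outDeg≡0 →
            0≢1+n (trans (sym outDeg≡0) (trans (outDeg≡ x) (+-comm (2 * l) 1))))
      in y , Bit≢0⇒≡1 (bit x y) Axy≢0

    common-out-neighbour : 0 < l → ∀ {x y} → x ≢ y → ∃ λ z → A x z ≡ 1 × A y z ≡ 1
    common-out-neighbour 0<l {x} {y} x≢y =
      let z , AxzAyz≢0 = Σ≢0⇒∃≢0 (λ z → A x z * A y z) (λ commonOut≡0 →
            >⇒≢ 0<l (trans (sym (commonOut≡ x≢y)) commonOut≡0))
      in z , Bit*≢0⇒≡1 (bit x z) (bit y z) AxzAyz≢0

    returns≡1+l : ∀ {x y} → A x y ≡ 1 → Σ (λ t → A y t * A t x) ≡ 1 + l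
    returns≡1+l {x} {y} Axy≡1 = +-cancelʳ-≡ l returns (1 + l) (begin
      returns + l                       ≡⟨ +-identityʳ (returns + l) ⟨
      returns + l + 0                   ≡⟨ cong₂ (λ c a → returns + c + a)
                                                 (commonOut≡ (arc⇒≢ Axy≡1)) (arc⇒reverse≡0 Axy≡1) ⟨
      returns + commonOut A x y + A y x ≡⟨ outDeg≡returns+commonOut x y ⟨
      outDeg A y                        ≡⟨ outDeg≡ y ⟩
      2 * l + 1                         ≡⟨ double+1 l ⟩
      1 + l + l                         ∎)
      where
      returns : ℕ
      returns = Σ (λ t → A y t * A t x)
      double+1 : ∀ l → 2 * l + 1 ≡ 1 + l + l
      double+1 = solve-∀

    return-path : ∀ {x y} → A x y ≡ 1 → ∃ λ u → A y u ≡ 1 × A u x ≡ 1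
    return-path {x} {y} Axy≡1 =
      let u , AyuAux≢0 = Σ≢0⇒∃≢0 (λ t → A y t * A t x) (λ returns≡0 →
            0≢1+n (trans (sym returns≡0) (returns≡1+l Axy≡1)))
      in u , Bit*≢0⇒≡1 (bit y u) (bit u x) AyuAux≢0

    transitive-triple : 0 < l → ∃ λ T → ∣ T ∣ ≡ 3 × occurrences blocks T ≡ l + 1
    transitive-triple 0<l =
      let y , xy      = out-neighbour vertex
          z , xz , yz = common-out-neighbour 0<l (arc⇒≢ xy)
      in triangle (arc⇒≢ xy) (arc⇒≢ xz) (arc⇒≢ yz) (beats-both⇒sourceCount≡1 xy xz)

    cyclic-triple : ∃ λ T → ∣ T ∣ ≡ 3 × occurrences blocks T ≡ l + 0
    cyclic-triple =
      let y , xy      = out-neighbour vertex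
          u , yu , ux = return-path xy
      in triangle (arc⇒≢ xy) (arc⇒≢ ux ∘ sym) (arc⇒≢ yu) (cyclic⇒sourceCount≡0 xy yu ux)

    not-design : 0 < l → ∀ {k} → ¬ ∃ (λ μ → IsDesign 3 k μ blocks)
    not-design 0<l (μ , _ , design) =
      let T₁ , ∣T₁∣≡3 , occurrences≡l+1 = transitive-triple 0<l
          T₀ , ∣T₀∣≡3 , occurrences≡l+0 = cyclic-triple
      in 0≢1+n (sym (+-cancelˡ-≡ l 1 0 (begin
           l + 1                 ≡⟨ occurrences≡l+1 ⟨
           occurrences blocks T₁ ≡⟨ design T₁ ∣T₁∣≡3 ⟩
           μ                     ≡⟨ design T₀ ∣T₀∣≡3 ⟨
           occurrences blocks T₀ ≡⟨ occurrences≡l+0 ⟩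
           l + 0                 ∎)))

corollary2 : ∀ {n} (A : Matrix n) → IsDoublyRegular A →
    let A′ = (J ⊖ I) ⊖ A
        𝓑 = blocksOf (A ⊕ I) ++ blocksOf (A′ ⊕ I)
    in (∀ k → 2 * k ≡ n + 1 → IsDesign 2 k k 𝓑) ×
       (∀ k l → 2 * k ≡ n + 1 → 4 * l + 3 ≡ n → 0 < l → IsADesign 3 k l 𝓑)
corollary2 A doublyRegular =
  (λ k 2k≡n+1 → block-sizes 2k≡n+1 , pair-count 2k≡n+1) ,
  (λ k l 2k≡n+1 4l+3≡n 0<l →
     0<l , block-sizes 2k≡n+1 , triple-count 4l+3≡n , not-design 4l+3≡n 0<l)
  where
  open DoublyRegular A doublyRegular
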